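{- Let $L$ be a finite lattice with a maximal chain $\hat0=x_0\lessdot x_1\lessdot\cdots\lessdot x_n=\hat1$ of left modular elements, and for a join-irreducible $v$ let $\delta(v)=\min\{i: v\le x_i\}$. If $y$ and $z$ are distinct join-irreducibles with $\delta(y)=\delta(z)$, then $y$ and $z$ are incomparable.
   Context: An element $x$ of a lattice $L$ is left modular if for all $y<z$ in $L$, $(y\vee x)\wedge z=y\vee(x\wedge z)$. A join-irreducible is an element other than $\hat0$ that is not the join of two strictly smaller elements. -}

module Defs where

open import Level using (Level; _⊔_)
open import Data.Nat using (ℕ; suc)
open import Data.Fin using (Fin; inject₁; fromℕ) renaming (zero to fzero; suc to fsuc; _≤_ to _≤ᶠ_)
open import Data.List using (List)
open import Data.List.Relation.Unary.Any using (Any)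
open import Data.Product using (Σ; _×_; ∃)
open import Relation.Nullary using (¬_)
open import Relation.Binary.Lattice.Bundles using (BoundedLattice)

module _ {c ℓ₁ ℓ₂ : Level} (L : BoundedLattice c ℓ₁ ℓ₂) where
  open BoundedLattice L

  _<_ : Carrier → Carrier → Set (ℓ₁ ⊔ ℓ₂)
  a < b = a ≤ b × ¬ (a ≈ b)

  _⋖_ : Carrier → Carrier → Set (c ⊔ ℓ₁ ⊔ ℓ₂)
  a ⋖ b = a < b × (∀ w → ¬ (a < w × w < b))

  IsFinite : Set (c ⊔ ℓ₁)
  IsFinite = Σ (List Carrier) λ xs → ∀ a → Any (a ≈_) xs

  LeftModular : Carrier → Set (c ⊔ ℓ₁ ⊔ ℓ₂)
  LeftModular x = ∀ y z → y < z → ((y ∨ x) ∧ z) ≈ (y ∨ (x ∧ z))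

  JoinIrreducible : Carrier → Set (c ⊔ ℓ₁ ⊔ ℓ₂)
  JoinIrreducible v = ¬ (v ≈ ⊥) × ¬ (∃ λ a → ∃ λ b → a < v × b < v × v ≈ (a ∨ b))

  LeftModularMaximalChain : (n : ℕ) → (Fin (suc n) → Carrier) → Set (c ⊔ ℓ₁ ⊔ ℓ₂)
  LeftModularMaximalChain n x =
    (x fzero ≈ ⊥) × (x (fromℕ n) ≈ ⊤) ×
    (∀ (i : Fin n) → x (inject₁ i) ⋖ x (fsuc i)) ×
    (∀ i → LeftModular (x i))

  IsDelta : (n : ℕ) → (Fin (suc n) → Carrier) → Carrier → Fin (suc n) → Set ℓ₂
  IsDelta n x v i = (v ≤ x i) × (∀ j → v ≤ x j → i ≤ᶠ j)

{-# OPTIONS --safe #-}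
module Submission where

-- Suppose y < z with z join-irreducible and δ(y) = δ(z) = i. Then i > 0, since z ≠ 0̂.
-- As y ≤ xᵢ but y ≰ xᵢ₋₁, the cover xᵢ₋₁ ⋖ xᵢ forces y ∨ xᵢ₋₁ = xᵢ ≥ z, and left
-- modularity of xᵢ₋₁ gives z = (y ∨ xᵢ₋₁) ∧ z = y ∨ (xᵢ₋₁ ∧ z). Join-irreducibility of z
-- then forces z ≤ xᵢ₋₁, contradicting δ(z) = i.

open import Defs hiding (_<_; _⋖_)
import Defs
open import Level using (Level; _⊔_)
open import Data.Nat using (ℕ; suc)
open import Data.Nat.Properties using (<⇒≱)
open import Data.Fin using (Fin; inject₁) renaming (zero to fzero; suc to fsuc)
open import Data.Fin.Properties using (≤-refl; ≤̄⇒inject₁<)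
open import Data.Product using (_×_; _,_)
open import Function using (_∘_)
open import Relation.Nullary using (¬_)
open import Relation.Binary.Lattice.Bundles using (BoundedLattice)

module _ {c ℓ₁ ℓ₂ : Level} (L : BoundedLattice c ℓ₁ ℓ₂) where
  open BoundedLattice L

  _<_ : Carrier → Carrier → Set (ℓ₁ ⊔ ℓ₂)
  _<_ = Defs._<_ L

  _⋖_ : Carrier → Carrier → Set (c ⊔ ℓ₁ ⊔ ℓ₂)
  _⋖_ = Defs._⋖_ L

  -- Equality is not decidable, so a cover only excludes the failure of this equation.
  ∨-reaches-cover : ∀ {a b v} → a ⋖ b → v ≤ b → ¬ v ≤ a → ¬ ¬ ((v ∨ a) ≈ b)
  ∨-reaches-cover {a} {b} {v} ((a≤b , _) , nothing-between) v≤b v≰a va≉b =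
    nothing-between (v ∨ a) ((y≤x∨y v a , a≉va) , (∨-least v≤b a≤b , va≉b))
    where
    a≉va : ¬ (a ≈ (v ∨ a))
    a≉va a≈va = v≰a (trans (x≤x∨y v a) (reflexive (Eq.sym a≈va)))

  leftModular-splits : ∀ {x y z} → LeftModular L x → y < z → z ≤ (y ∨ x) →
                       z ≈ (y ∨ (x ∧ z))
  leftModular-splits {x} {y} {z} x-leftModular y<z z≤yx = Eq.trans z≈yx∧z (x-leftModular y z y<z)
    where
    z≈yx∧z : z ≈ ((y ∨ x) ∧ z)
    z≈yx∧z = antisym (∧-greatest z≤yx refl) (x∧y≤y (y ∨ x) z)

  joinIrreducible-≰-∨-leftModular : ∀ {x y z} → JoinIrreducible L z → LeftModular L x →
                                    y < z → ¬ z ≤ x → ¬ z ≤ (y ∨ x)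
  joinIrreducible-≰-∨-leftModular {x} {y} {z} (_ , irreducible) x-leftModular y<z z≰x z≤yx =
    irreducible (y , (x ∧ z) , y<z , (x∧y≤y x z , x∧z≉z) , leftModular-splits x-leftModular y<z z≤yx)
    where
    x∧z≉z : ¬ ((x ∧ z) ≈ z)
    x∧z≉z x∧z≈z = z≰x (trans (reflexive (Eq.sym x∧z≈z)) (x∧y≤x x z))

  IsDelta-suc⇒≰ : ∀ {n} {x : Fin (suc n) → Carrier} {v k} →
                  IsDelta L n x v (fsuc k) → ¬ v ≤ x (inject₁ k)
  IsDelta-suc⇒≰ {k = k} (_ , minimal) v≤xₖ =
    <⇒≱ (≤̄⇒inject₁< (≤-refl {x = k})) (minimal (inject₁ k) v≤xₖ)

  IsDelta-differs-below-joinIrreducible :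
    ∀ {n x y z} → LeftModularMaximalChain L n x → JoinIrreducible L z → y < z →
    (i : Fin (suc n)) → IsDelta L n x y i → ¬ IsDelta L n x z i
  IsDelta-differs-below-joinIrreducible (x₀≈⊥ , _) (z≉⊥ , _) _ fzero _ (z≤x₀ , _) =
    z≉⊥ (antisym (trans z≤x₀ (reflexive x₀≈⊥)) (minimum _))
  IsDelta-differs-below-joinIrreducible (_ , _ , covers , leftModular) z-irreducible y<z
                                       (fsuc k) δy@(y≤xᵢ , _) δz@(z≤xᵢ , _) =
    ∨-reaches-cover (covers k) y≤xᵢ (IsDelta-suc⇒≰ δy) λ y∨xₖ≈xᵢ →
      joinIrreducible-≰-∨-leftModular z-irreducible (leftModular (inject₁ k)) y<z
        (IsDelta-suc⇒≰ δz) (trans z≤xᵢ (reflexive (Eq.sym y∨xₖ≈xᵢ)))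

lemma1 : {c ℓ₁ ℓ₂ : Level} (L : BoundedLattice c ℓ₁ ℓ₂) → IsFinite L →
    (n : ℕ) (x : Fin (suc n) → BoundedLattice.Carrier L) → LeftModularMaximalChain L n x →
    (y z : BoundedLattice.Carrier L) → JoinIrreducible L y → JoinIrreducible L z →
    ¬ (BoundedLattice._≈_ L y z) →
    (i : Fin (suc n)) → IsDelta L n x y i → IsDelta L n x z i →
    ¬ (BoundedLattice._≤_ L y z) × ¬ (BoundedLattice._≤_ L z y)
lemma1 L _ n x chain y z y-irreducible z-irreducible y≉z i δy δz =
  (λ y≤z → IsDelta-differs-below-joinIrreducible L chain z-irreducible (y≤z , y≉z) i δy δz) ,
  (λ z≤y → IsDelta-differs-below-joinIrreducible L chain y-irreducible (z≤y , y≉z ∘ Eq.sym) i δz δy)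
  where open BoundedLattice L using (module Eq)
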